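{- Let $\ast$ be a uniformity preserving operation on a finite set $\mathcal{X}$ and let $\mathcal{H}$ be a periodic partition of $(\mathcal{X},\ast)$. Then for every $n>0$, $\mathcal{H}^{n\ast}$ is a periodic partition and $\mathrm{per}(\mathcal{H}^{n\ast})=\mathrm{per}(\mathcal{H})$.
   Context: $\ast$ is uniformity preserving if for every $b$ the map $x\mapsto x\ast b$ is a bijection of $\mathcal{X}$. For $A,B\subset\mathcal{X}$, $A\ast B=\{a\ast b:a\in A,b\in B\}$. For a set $\mathcal{H}$ of subsets of $\mathcal{X}$, $\mathcal{H}^{\ast}=\{A\ast B:A,B\in\mathcal{H}\}$, $\mathcal{H}^{0\ast}=\mathcal{H}$, $\mathcal{H}^{n\ast}=(\mathcal{H}^{(n-1)\ast})^{\ast}$. A partition $\mathcal{H}$ of $\mathcal{X}$ is periodic if $\mathcal{H}^{n\ast}=\mathcal{H}$ for some $n>0$; the least such $n$ is its period $\mathrm{per}(\mathcal{H})$. -}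

module Defs where

open import Data.Nat using (ℕ; zero; suc; _<_)
open import Data.Bool using (Bool; true; false)
open import Data.Fin using (Fin)
open import Data.Fin.Subset using (Subset; _∈_; _∩_; Nonempty; Empty)
open import Data.Fin.Subset.Properties using (_∈?_)
open import Data.Fin.Properties using (any?)
open import Data.Vec using (tabulate)
open import Data.Product using (Σ; ∃; ∃-syntax; _×_; _,_)
open import Relation.Nullary using (¬_; Dec; _×-dec_)
open import Relation.Nullary.Decidable using (⌊_⌋)
open import Relation.Binary.PropositionalEquality using (_≡_; _≢_)
open import Function.Definitions using (Bijective)
open import Data.Fin using (_≟_)

Op : ℕ → Set
Op m = Fin m → Fin m → Fin m

UniformityPreserving : ∀ {m} → Op m → Set
UniformityPreserving {m} _∗_ = ∀ (b : Fin m) → Bijective _≡_ _≡_ (λ x → x ∗ b)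

_⊛_ : ∀ {m} → Op m → Subset m → Subset m → Subset m
_⊛_ {m} _∗_ A B = λ-tab
  where
  λ-tab : Subset m
  λ-tab = tabulate λ x → ⌊ any? (λ a → any? (λ b →
            (a ∈? A) ×-dec ((b ∈? B) ×-dec ((a ∗ b) ≟ x)))) ⌋

Family : ℕ → Set₁
Family m = Subset m → Set

_≐_ : ∀ {m} → Family m → Family m → Set
H ≐ G = ∀ C → (H C → G C) × (G C → H C)

star : ∀ {m} → Op m → Family m → Family m
star _∗_ H C = ∃[ A ] ∃[ B ] (H A × H B × C ≡ _⊛_ _∗_ A B)

starIter : ∀ {m} → Op m → ℕ → Family m → Family m
starIter _∗_ zero H = H
starIter _∗_ (suc n) H = star _∗_ (starIter _∗_ n H)

IsPartition : ∀ {m} → Family m → Set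
IsPartition {m} H =
  (∀ A → H A → Nonempty A) ×
  (∀ A B → H A → H B → A ≢ B → Empty (A ∩ B)) ×
  (∀ (x : Fin m) → ∃[ A ] (H A × x ∈ A))

IsPeriodicPartition : ∀ {m} → Op m → Family m → Set
IsPeriodicPartition _∗_ H =
  IsPartition H × ∃[ n ] (0 < n × starIter _∗_ n H ≐ H)

IsPeriod : ∀ {m} → Op m → Family m → ℕ → Set
IsPeriod _∗_ H p =
  0 < p × starIter _∗_ p H ≐ H ×
  (∀ q → 0 < q → q < p → ¬ (starIter _∗_ q H ≐ H))

module Submission where

-- Right multiplication by b permutes 𝒳, so a product A ∗ B ⊇ A ∗ b is never smaller than A.
-- Assign to each point y a set V y all of whose points share a block with some partner τ y,
-- τ a permutation. Multiplying everything by b passes to the next star without shrinking any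
-- V y, so once the iteration returns to a partition 𝒦 the total Σ ∣V y∣ is at most Σ ∣block y∣.
-- If two distinct blocks C, D of 𝒦^∗ met at a ∗ b, with a in the block A, then C ∪ D could
-- serve as V a although it is strictly larger than A, while every other V y is as large as its
-- block: a contradiction. So every ℋ^{n∗} is a partition, and ℋ and ℋ^{n∗} have the same periods
-- because, up to ℋ^{p∗} = ℋ, each is an iterate of the other.

open import Defs
open import Data.Nat using (ℕ; _<_)
open import Data.Product using (_×_)

open import Level using (0ℓ) renaming (suc to lsuc)
open import Data.Nat using (zero; suc; _+_; _*_; _≤_; z≤n)
open import Data.Nat.Properties
  using (≤-refl; ≤-trans; +-mono-≤; +-mono-<-≤; +-mono-≤-<; ≮⇒≥; <⇒≱; +-comm; *-suc; +-0-commutativeMonoid;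
         module ≤-Reasoning)
open import Data.Bool using (if_then_else_)
import Data.Bool.Properties as Bool
open import Data.Fin as Fin using (Fin; _≟_)
open import Data.Fin.Subset using (Subset; _∈_; _∩_; _∪_; _⊆_; ⁅_⁆; ∣_∣; Nonempty; Empty; inside; outside)
open import Data.Fin.Subset.Properties
  using (_∈?_; x∈⁅x⁆; x∈⁅y⁆⇒x≡y; x∈p∩q⁺; x∈p∩q⁻; x∈p∪q⁻; p⊆p∪q; q⊆p∪q; ⊆-antisym; p⊆q⇒∣p∣≤∣q∣; p⊂q⇒∣p∣<∣q∣)
import Data.Fin.Permutation as Perm
open import Data.Fin.Permutation using (Permutation; _⟨$⟩ʳ_; _⟨$⟩ˡ_; _∘ₚ_; inverseʳ)
open import Data.Vec using (_∷_; []; lookup; tabulate)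
open import Data.Vec.Properties using (lookup∘tabulate; []=⇒lookup; lookup⇒[]=; ≡-dec)
open import Data.Product using (∃-syntax; _,_; proj₁; proj₂)
open import Data.Sum using (inj₁; inj₂)
open import Function using (_∘_; Equivalence)
open import Function.Bundles using (mk⤖)
open import Function.Properties.Bijection using (⤖⇒↔)
open import Relation.Binary.Bundles using (Setoid)
open import Relation.Nullary using (Dec; yes; no; contradiction)
open import Relation.Nullary.Decidable using (⌊_⌋; toWitness; fromWitness)
open import Relation.Binary.PropositionalEquality using (_≡_; _≢_; refl; sym; trans; cong; subst)
open import Algebra.Properties.CommutativeMonoid.Sum +-0-commutativeMonoid using (sum; sum-permute)

sum-mono-≤ : ∀ {n} {f g : Fin n → ℕ} → (∀ i → f i ≤ g i) → sum f ≤ sum g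
sum-mono-≤ {zero}  f≤g = z≤n
sum-mono-≤ {suc n} f≤g = +-mono-≤ (f≤g Fin.zero) (sum-mono-≤ (f≤g ∘ Fin.suc))

sum-mono-< : ∀ {n} {f g : Fin n → ℕ} → (∀ i → f i ≤ g i) → ∀ {j} → f j < g j → sum f < sum g
sum-mono-< f≤g {Fin.zero}  fj<gj = +-mono-<-≤ fj<gj (sum-mono-≤ (f≤g ∘ Fin.suc))
sum-mono-< f≤g {Fin.suc j} fj<gj = +-mono-≤-< (f≤g Fin.zero) (sum-mono-< (f≤g ∘ Fin.suc) fj<gj)

f≤g∧∑g≤∑f⇒g≤f : ∀ {n} {f g : Fin n → ℕ} → (∀ i → f i ≤ g i) → sum g ≤ sum f → ∀ i → g i ≤ f i
f≤g∧∑g≤∑f⇒g≤f f≤g ∑g≤∑f i = ≮⇒≥ (λ fi<gi → <⇒≱ (sum-mono-< f≤g fi<gi) ∑g≤∑f)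

∣p∣≡sum : ∀ {n} (p : Subset n) → ∣ p ∣ ≡ sum (λ i → if lookup p i then 1 else 0)
∣p∣≡sum []            = refl
∣p∣≡sum (inside  ∷ p) = cong suc (∣p∣≡sum p)
∣p∣≡sum (outside ∷ p) = ∣p∣≡sum p

π[p]⊆q⇒∣p∣≤∣q∣ : ∀ {n} (π : Permutation n n) {p q : Subset n} →
                 (∀ {i} → i ∈ p → π ⟨$⟩ʳ i ∈ q) → ∣ p ∣ ≤ ∣ q ∣
π[p]⊆q⇒∣p∣≤∣q∣ π {p} {q} π[p]⊆q = begin
  ∣ p ∣                                          ≡⟨ ∣p∣≡sum p ⟩
  sum (λ i → if lookup p i then 1 else 0)        ≤⟨ sum-mono-≤ pointwise ⟩
  sum (λ i → if lookup q (π ⟨$⟩ʳ i) then 1 else 0) ≡⟨ sum-permute _ π ⟨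
  sum (λ i → if lookup q i then 1 else 0)        ≡⟨ ∣p∣≡sum q ⟨
  ∣ q ∣                                          ∎
  where
  open ≤-Reasoning
  pointwise : ∀ i → (if lookup p i then 1 else 0) ≤ (if lookup q (π ⟨$⟩ʳ i) then 1 else 0)
  pointwise i with lookup p i in i∈p
  ... | outside = z≤n
  ... | inside rewrite []=⇒lookup (π[p]⊆q (lookup⇒[]= i p i∈p)) = ≤-refl

p⊆q∧∣q∣≤∣p∣⇒q⊆p : ∀ {n} {p q : Subset n} → p ⊆ q → ∣ q ∣ ≤ ∣ p ∣ → q ⊆ p
p⊆q∧∣q∣≤∣p∣⇒q⊆p {p = p} p⊆q ∣q∣≤∣p∣ {x} x∈q with x ∈? p
... | yes x∈p = x∈p
... | no  x∉p = contradiction ∣q∣≤∣p∣ (<⇒≱ (p⊂q⇒∣p∣<∣q∣ (p⊆q , x , x∈q , x∉p)))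

∈-tabulate⁺ : ∀ {n} {P : Fin n → Set} (P? : ∀ x → Dec (P x)) {x} → P x → x ∈ tabulate (λ y → ⌊ P? y ⌋)
∈-tabulate⁺ P? {x} px =
  lookup⇒[]= x _ (trans (lookup∘tabulate _ x) (Equivalence.to Bool.T-≡ (fromWitness px)))

∈-tabulate⁻ : ∀ {n} {P : Fin n → Set} (P? : ∀ x → Dec (P x)) {x} → x ∈ tabulate (λ y → ⌊ P? y ⌋) → P x
∈-tabulate⁻ P? {x} x∈ =
  toWitness (Equivalence.from Bool.T-≡ (trans (sym (lookup∘tabulate _ x)) ([]=⇒lookup x∈)))

≐-setoid : ℕ → Setoid (lsuc 0ℓ) 0ℓ
≐-setoid m = record
  { Carrier       = Family m
  ; _≈_           = _≐_
  ; isEquivalence = record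
    { refl  = λ C → (λ x → x) , (λ x → x)
    ; sym   = λ F≐G C → proj₂ (F≐G C) , proj₁ (F≐G C)
    ; trans = λ F≐G G≐H C → proj₁ (G≐H C) ∘ proj₁ (F≐G C) , proj₂ (F≐G C) ∘ proj₂ (G≐H C)
    }
  }

module _ {m : ℕ} (_∗_ : Op m) where

  open Setoid (≐-setoid m) using () renaming (refl to ≐-refl)
  open import Relation.Binary.Reasoning.Setoid (≐-setoid m)

  star-cong : ∀ {F G : Family m} → F ≐ G → star _∗_ F ≐ star _∗_ G
  star-cong F≐G C =
    (λ (A , B , FA , FB , C≡A∗B) → A , B , proj₁ (F≐G A) FA , proj₁ (F≐G B) FB , C≡A∗B) ,
    (λ (A , B , GA , GB , C≡A∗B) → A , B , proj₂ (F≐G A) GA , proj₂ (F≐G B) GB , C≡A∗B)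

  starIter-cong : ∀ r {F G : Family m} → F ≐ G → starIter _∗_ r F ≐ starIter _∗_ r G
  starIter-cong zero    F≐G = F≐G
  starIter-cong (suc r) F≐G = star-cong (starIter-cong r F≐G)

  starIter-+ : ∀ a b (F : Family m) → starIter _∗_ a (starIter _∗_ b F) ≡ starIter _∗_ (a + b) F
  starIter-+ zero    b F = refl
  starIter-+ (suc a) b F = cong (star _∗_) (starIter-+ a b F)

  starIter-suc : ∀ r (F : Family m) → starIter _∗_ (suc r) F ≡ starIter _∗_ r (star _∗_ F)
  starIter-suc zero    F = refl
  starIter-suc (suc r) F = cong (star _∗_) (starIter-suc r F)

  starIter-comm : ∀ a b (F : Family m) →
                  starIter _∗_ a (starIter _∗_ b F) ≡ starIter _∗_ b (starIter _∗_ a F)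
  starIter-comm a b F =
    trans (starIter-+ a b F)
          (trans (cong (λ k → starIter _∗_ k F) (+-comm a b)) (sym (starIter-+ b a F)))

  starIter-fixed : ∀ p {F : Family m} → starIter _∗_ p F ≐ F →
                   ∀ j → starIter _∗_ p (starIter _∗_ j F) ≐ starIter _∗_ j F
  starIter-fixed p {F} Fᵖ≐F j = begin
    starIter _∗_ p (starIter _∗_ j F)   ≡⟨ starIter-comm p j F ⟩
    starIter _∗_ j (starIter _∗_ p F)   ≈⟨ starIter-cong j Fᵖ≐F ⟩
    starIter _∗_ j F                    ∎

  starIter-return : ∀ {p′} {F : Family m} → starIter _∗_ (suc p′) F ≐ F →
                    ∀ n → starIter _∗_ (n * p′) (starIter _∗_ n F) ≐ F
  starIter-return {p′} {F} Fᵖ≐F n = begin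
    starIter _∗_ (n * p′) (starIter _∗_ n F)  ≡⟨ starIter-+ (n * p′) n F ⟩
    starIter _∗_ (n * p′ + n) F               ≡⟨ cong (λ k → starIter _∗_ k F) n*p′+n≡n*p ⟩
    starIter _∗_ (n * suc p′) F               ≈⟨ multiple n ⟩
    F                                         ∎
    where
    n*p′+n≡n*p : n * p′ + n ≡ n * suc p′
    n*p′+n≡n*p = trans (+-comm (n * p′) n) (sym (*-suc n p′))

    multiple : ∀ k → starIter _∗_ (k * suc p′) F ≐ F
    multiple zero    = ≐-refl
    multiple (suc k) = begin
      starIter _∗_ (suc p′ + k * suc p′) F                  ≡⟨ starIter-+ (suc p′) (k * suc p′) F ⟨
      starIter _∗_ (suc p′) (starIter _∗_ (k * suc p′) F)   ≈⟨ starIter-cong (suc p′) (multiple k) ⟩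
      starIter _∗_ (suc p′) F                               ≈⟨ Fᵖ≐F ⟩
      F                                                     ∎

  periodic-iterate⇒periodic : ∀ p q n {F : Family m} → 0 < p → starIter _∗_ p F ≐ F →
                              starIter _∗_ q (starIter _∗_ n F) ≐ starIter _∗_ n F → starIter _∗_ q F ≐ F
  periodic-iterate⇒periodic (suc p′) q n {F} _ Fᵖ≐F Xᵠ≐X = begin
    starIter _∗_ q F                                               ≈⟨ starIter-cong q (starIter-return Fᵖ≐F n) ⟨
    starIter _∗_ q (starIter _∗_ (n * p′) (starIter _∗_ n F))      ≡⟨ starIter-comm q (n * p′) _ ⟩
    starIter _∗_ (n * p′) (starIter _∗_ q (starIter _∗_ n F))      ≈⟨ starIter-cong (n * p′) Xᵠ≐X ⟩
    starIter _∗_ (n * p′) (starIter _∗_ n F)                       ≈⟨ starIter-return Fᵖ≐F n ⟩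
    F                                                              ∎

module Blocks {m : ℕ} {K : Family m} (K-partition : IsPartition K) where

  block : Fin m → Subset m
  block x = proj₁ (proj₂ (proj₂ K-partition) x)

  block∈K : ∀ x → K (block x)
  block∈K x = proj₁ (proj₂ (proj₂ (proj₂ K-partition) x))

  x∈block : ∀ x → x ∈ block x
  x∈block x = proj₂ (proj₂ (proj₂ (proj₂ K-partition) x))

  block-unique : ∀ {C x} → K C → x ∈ C → C ≡ block x
  block-unique {C} {x} C∈K x∈C with ≡-dec Bool._≟_ C (block x)
  ... | yes C≡block = C≡block
  ... | no  C≢block = contradiction (x , x∈p∩q⁺ (x∈C , x∈block x))
                        (proj₁ (proj₂ K-partition) C (block x) C∈K (block∈K x) C≢block)

module _ {m : ℕ} (_∗_ : Op m) where

  infixl 7 _∗ˢ_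
  _∗ˢ_ : Subset m → Subset m → Subset m
  A ∗ˢ B = _⊛_ _∗_ A B

  ∗ˢ-intro : ∀ {A B a b} → a ∈ A → b ∈ B → a ∗ b ∈ A ∗ˢ B
  ∗ˢ-intro {a = a} {b} a∈A b∈B = ∈-tabulate⁺ _ (a , b , a∈A , b∈B , refl)

  ∗ˢ-elim : ∀ {A B x} → x ∈ A ∗ˢ B → ∃[ a ] ∃[ b ] (a ∈ A × b ∈ B × a ∗ b ≡ x)
  ∗ˢ-elim = ∈-tabulate⁻ _

  Covers : Family m → Set
  Covers F = ∀ x → ∃[ A ] (F A × x ∈ A)

  star-nonempty : ∀ {F} → (∀ A → F A → Nonempty A) → ∀ C → star _∗_ F C → Nonempty C
  star-nonempty F-nonempty C (A , B , FA , FB , refl) with F-nonempty A FA | F-nonempty B FB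
  ... | a , a∈A | b , b∈B = a ∗ b , ∗ˢ-intro a∈A b∈B

  Linked : Family m → Permutation m m → (Fin m → Subset m) → Set
  Linked F τ V = ∀ y {w} → w ∈ V y → ∃[ C ] (F C × τ ⟨$⟩ʳ y ∈ C × w ∈ C)

  module _ (uniform : UniformityPreserving _∗_) where

    rightMul : Fin m → Permutation m m
    rightMul b = ⤖⇒↔ (mk⤖ (uniform b))

    star-covers : ∀ {F} → Covers F → Covers (star _∗_ F)
    star-covers F-covers x with F-covers (rightMul x ⟨$⟩ˡ x) | F-covers x
    ... | A , FA , y∈A | B , FB , x∈B =
      A ∗ˢ B , (A , B , FA , FB , refl) , subst (_∈ A ∗ˢ B) (inverseʳ (rightMul x)) (∗ˢ-intro y∈A x∈B)

    linked-star : ∀ {F τ V} b → Covers F → Linked F τ V →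
                  Linked (star _∗_ F) (τ ∘ₚ rightMul b) (λ y → V y ∗ˢ ⁅ b ⁆)
    linked-star b F-covers linked y w∈Vy∗b with ∗ˢ-elim w∈Vy∗b
    ... | v , b′ , v∈Vy , b′∈⁅b⁆ , refl with x∈⁅y⁆⇒x≡y b b′∈⁅b⁆ | linked y v∈Vy | F-covers b
    ... | refl | C , FC , τy∈C , v∈C | B , FB , b∈B =
      C ∗ˢ B , (C , B , FC , FB , refl) , ∗ˢ-intro τy∈C b∈B , ∗ˢ-intro v∈C b∈B

    ∣A∣≤∣A∗b∣ : ∀ A b → ∣ A ∣ ≤ ∣ A ∗ˢ ⁅ b ⁆ ∣
    ∣A∣≤∣A∗b∣ A b = π[p]⊆q⇒∣p∣≤∣q∣ (rightMul b) (λ a∈A → ∗ˢ-intro a∈A (x∈⁅x⁆ b))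

    module _ {K : Family m} (K-partition : IsPartition K) where
      open Blocks K-partition

      linked⇒sum≤ : ∀ b r {F τ V} → Covers F → starIter _∗_ r F ≐ K → Linked F τ V →
                    sum (λ y → ∣ V y ∣) ≤ sum (λ y → ∣ block y ∣)
      linked⇒sum≤ b zero {F} {τ} {V} _ F≐K linked = begin
        sum (λ y → ∣ V y ∣)                ≤⟨ sum-mono-≤ (λ y → p⊆q⇒∣p∣≤∣q∣ (V⊆block y)) ⟩
        sum (λ y → ∣ block (τ ⟨$⟩ʳ y) ∣)   ≡⟨ sum-permute _ τ ⟨
        sum (λ y → ∣ block y ∣)            ∎
        where
        open ≤-Reasoning
        V⊆block : ∀ y → V y ⊆ block (τ ⟨$⟩ʳ y)
        V⊆block y {w} w∈Vy with linked y w∈Vy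
        ... | C , FC , τy∈C , w∈C = subst (w ∈_) (block-unique (proj₁ (F≐K C) FC) τy∈C) w∈C
      linked⇒sum≤ b (suc r) {F} {τ} {V} F-covers Fʳ⁺¹≐K linked = begin
        sum (λ y → ∣ V y ∣)             ≤⟨ sum-mono-≤ (λ y → ∣A∣≤∣A∗b∣ (V y) b) ⟩
        sum (λ y → ∣ V y ∗ˢ ⁅ b ⁆ ∣)    ≤⟨ linked⇒sum≤ b r {τ = τ ∘ₚ rightMul b} (star-covers F-covers) F*ʳ≐K
                                             (linked-star {F} {τ} {V} b F-covers linked) ⟩
        sum (λ y → ∣ block y ∣)         ∎
        where
        open ≤-Reasoning
        F*ʳ≐K : starIter _∗_ r (star _∗_ F) ≐ K
        F*ʳ≐K = subst (_≐ K) (starIter-suc _∗_ r F) Fʳ⁺¹≐K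

      -- By the sum bound no V y exceeds its block; at y = a this squeezes C ∪ D into A ∗ b ⊆ C.
      star-overlap⇒⊆ : ∀ {q C D x} → starIter _∗_ q (star _∗_ K) ≐ K →
                       star _∗_ K C → star _∗_ K D → x ∈ C → x ∈ D → D ⊆ C
      star-overlap⇒⊆ {q} {C} {D} K-period (A , B , A∈K , B∈K , refl) D∈K* x∈C x∈D with ∗ˢ-elim x∈C
      ... | a , b , a∈A , b∈B , refl = A∗b⊆C ∘ C∪D⊆A∗b ∘ q⊆p∪q C D
        where
        A∗b⊆C : A ∗ˢ ⁅ b ⁆ ⊆ C
        A∗b⊆C w∈A∗b with ∗ˢ-elim w∈A∗b
        ... | a′ , b′ , a′∈A , b′∈⁅b⁆ , refl with x∈⁅y⁆⇒x≡y b b′∈⁅b⁆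
        ... | refl = ∗ˢ-intro a′∈A b∈B

        V : Fin m → Subset m
        V y with y ≟ a
        ... | yes _ = C ∪ D
        ... | no  _ = block y ∗ˢ ⁅ b ⁆

        block-linked : Linked K Perm.id block
        block-linked y {w} w∈block = block y , block∈K y , x∈block y , w∈block

        V-linked : Linked (star _∗_ K) (rightMul b) V
        V-linked y w∈Vy with y ≟ a
        ... | no  _ = linked-star {τ = Perm.id} b (proj₂ (proj₂ K-partition)) block-linked y w∈Vy
        ... | yes refl with x∈p∪q⁻ C D w∈Vy
        ...   | inj₁ w∈C = C , (A , B , A∈K , B∈K , refl) , x∈C , w∈C
        ...   | inj₂ w∈D = D , D∈K* , x∈D , w∈D

        ∣block∣≤∣V∣ : ∀ y → ∣ block y ∣ ≤ ∣ V y ∣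
        ∣block∣≤∣V∣ y with y ≟ a
        ... | no  _ = ∣A∣≤∣A∗b∣ (block y) b
        ... | yes refl rewrite sym (block-unique A∈K a∈A) =
          ≤-trans (∣A∣≤∣A∗b∣ A b) (p⊆q⇒∣p∣≤∣q∣ (p⊆p∪q D ∘ A∗b⊆C))

        ∣V∣≤∣block∣ : ∀ y → ∣ V y ∣ ≤ ∣ block y ∣
        ∣V∣≤∣block∣ = f≤g∧∑g≤∑f⇒g≤f ∣block∣≤∣V∣
          (linked⇒sum≤ b q {τ = rightMul b} (star-covers (proj₂ (proj₂ K-partition))) K-period V-linked)

        ∣C∪D∣≤∣A∗b∣ : ∣ C ∪ D ∣ ≤ ∣ A ∗ˢ ⁅ b ⁆ ∣
        ∣C∪D∣≤∣A∗b∣ with a ≟ a | ∣V∣≤∣block∣ a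
        ... | no  a≢a | _          = contradiction refl a≢a
        ... | yes _   | ∣C∪D∣≤∣blk∣ rewrite sym (block-unique A∈K a∈A) =
          ≤-trans ∣C∪D∣≤∣blk∣ (∣A∣≤∣A∗b∣ A b)

        C∪D⊆A∗b : C ∪ D ⊆ A ∗ˢ ⁅ b ⁆
        C∪D⊆A∗b = p⊆q∧∣q∣≤∣p∣⇒q⊆p (p⊆p∪q D ∘ A∗b⊆C) ∣C∪D∣≤∣A∗b∣

    star-partition : ∀ {q K} → IsPartition K → starIter _∗_ (suc q) K ≐ K → IsPartition (star _∗_ K)
    star-partition {q} {K} K-partition K-period =
      star-nonempty (proj₁ K-partition) , disjoint , star-covers (proj₂ (proj₂ K-partition))
      where
      K*-period : starIter _∗_ q (star _∗_ K) ≐ K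
      K*-period = subst (_≐ K) (starIter-suc _∗_ q K) K-period

      disjoint : ∀ C D → star _∗_ K C → star _∗_ K D → C ≢ D → Empty (C ∩ D)
      disjoint C D C∈K* D∈K* C≢D (x , x∈C∩D) with x∈p∩q⁻ C D x∈C∩D
      ... | x∈C , x∈D = C≢D (⊆-antisym (star-overlap⇒⊆ K-partition {q} K*-period D∈K* C∈K* x∈D x∈C)
                                       (star-overlap⇒⊆ K-partition {q} K*-period C∈K* D∈K* x∈C x∈D))

    starIter-partition : ∀ q {H} → IsPartition H → starIter _∗_ (suc q) H ≐ H →
                         ∀ j → IsPartition (starIter _∗_ j H)
    starIter-partition q H-partition H-period zero    = H-partition
    starIter-partition q H-partition H-period (suc j) =
      star-partition {q} (starIter-partition q H-partition H-period j)
                         (starIter-fixed _∗_ (suc q) H-period j)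

mainTheorem7 : ∀ (m : ℕ) (_∗_ : Op m) (H : Family m)
    → UniformityPreserving _∗_
    → IsPeriodicPartition _∗_ H
    → ∀ (n : ℕ) → 0 < n
    → IsPeriodicPartition _∗_ (starIter _∗_ n H)
      × (∀ (p : ℕ) → IsPeriod _∗_ H p → IsPeriod _∗_ (starIter _∗_ n H) p)
mainTheorem7 m _∗_ H uniform (H-partition , suc q , 0<q+1 , H-period) n _ =
  ( starIter-partition _∗_ uniform q H-partition H-period n
  , suc q , 0<q+1 , starIter-fixed _∗_ (suc q) H-period n ) ,
  λ p (0<p , Hᵖ≐H , p-least) →
    0<p , starIter-fixed _∗_ p Hᵖ≐H n ,
    λ q′ 0<q′ q′<p Xᵠ′≐X → p-least q′ 0<q′ q′<p (periodic-iterate⇒periodic _∗_ p q′ n 0<p Hᵖ≐H Xᵠ′≐X)
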